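{- Let $G$ be a finite noncyclic nilpotent group of order $n=p_1^{\alpha_1}\cdots p_r^{\alpha_r}$ with $p_1<\cdots<p_r$ primes, $\alpha_i\ge1$, $r\geq2$, and let $P_i$ be the Sylow $p_i$-subgroup of $G$. Suppose that $\delta(\mathcal{P}(G))=\deg(x)$ for some $x\in G\setminus\{e\}$ that is contained in a unique element of $\mathcal{M}(G)$. Then $P_k$ is cyclic for every $k\in[r]\setminus\tau_x$. In particular, $\tau_x=[r]$ if every Sylow subgroup of $G$ is noncyclic.
   Context: The power graph $\mathcal{P}(G)$ has vertex set $G$, with two distinct vertices adjacent iff one is a positive power of the other; $\deg$ denotes degree in $\mathcal{P}(G)$ and $\delta(\mathcal{P}(G))$ its minimum degree. $\mathcal{M}(G)$ is the set of maximal cyclic subgroups of $G$. Every $x\in G$ is written uniquely as $x=x_1\cdots x_r$ with $x_i\in P_i$, and $\tau_x=\{j\in[r]:x_j\neq e\}$, where $e$ is the identity and $[r]=\{1,\dots,r\}$. -}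

module Defs where

open import Level using (0ℓ)
open import Data.Nat using (ℕ; zero; suc; _*_; _^_; _≤_)
open import Data.Fin using (Fin; zero; suc)
open import Data.Fin.Subset using (Subset; _∈_; ∣_∣)
open import Data.Product using (Σ; ∃; _×_; _,_)
open import Data.Sum using (_⊎_)
open import Relation.Binary.PropositionalEquality using (_≡_; _≢_)
open import Relation.Nullary using (¬_)
open import Algebra.Core using (Op₁; Op₂)
open import Algebra.Structures using (IsGroup)

∏ : ∀ {r} → (Fin r → ℕ) → ℕ
∏ {zero}  f = 1
∏ {suc r} f = f zero * ∏ (λ i → f (suc i))

record FinGroup (n : ℕ) : Set where
  infixl 7 _∙_
  field
    _∙_     : Op₂ (Fin n)
    ε       : Fin n
    _⁻¹     : Op₁ (Fin n)
    isGroup : IsGroup _≡_ _∙_ ε _⁻¹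

  pow : Fin n → ℕ → Fin n
  pow g zero    = ε
  pow g (suc m) = g ∙ pow g m

  gprod : ∀ {r} → (Fin r → Fin n) → Fin n
  gprod {zero}  xs = ε
  gprod {suc r} xs = xs zero ∙ gprod (λ i → xs (suc i))

  InCyc : Fin n → Fin n → Set
  InCyc g h = ∃ λ m → pow g m ≡ h

  IsCyclicGroup : Set
  IsCyclicGroup = ∃ λ g → ∀ h → InCyc g h

  IsSubgroup : Subset n → Set
  IsSubgroup S = (ε ∈ S) × (∀ {a b} → a ∈ S → b ∈ S → (a ∙ b) ∈ S)
               × (∀ {a} → a ∈ S → (a ⁻¹) ∈ S)

  IsCyclicSub : Subset n → Set
  IsCyclicSub S = ∃ λ g → g ∈ S × (∀ h → h ∈ S → InCyc g h)

  IsSylow : ℕ → ℕ → Subset n → Set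
  IsSylow p α S = IsSubgroup S × ∣ S ∣ ≡ p ^ α

  -- nilpotency via the upper central series Z₀ = {e}, Z_{i+1}/Z_i = Z(G/Z_i)
  commutator : Fin n → Fin n → Fin n
  commutator g h = (g ⁻¹) ∙ (h ⁻¹) ∙ g ∙ h

  Zser : ℕ → Fin n → Set
  Zser zero    g = g ≡ ε
  Zser (suc i) g = ∀ h → Zser i (commutator g h)

  IsNilpotent : Set
  IsNilpotent = ∃ λ c → ∀ g → Zser c g

  Adj : Fin n → Fin n → Set
  Adj x y = x ≢ y × ((∃ λ m → pow x (suc m) ≡ y) ⊎ (∃ λ m → pow y (suc m) ≡ x))

  -- S is the (open) neighbourhood set of x in the power graph; deg x = ∣ S ∣
  IsNbhd : Fin n → Subset n → Set
  IsNbhd x S = ∀ y → (y ∈ S → Adj x y) × (Adj x y → y ∈ S)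

  HasMinDegree : Fin n → Set
  HasMinDegree x = ∀ y (S T : Subset n) → IsNbhd x S → IsNbhd y T → ∣ S ∣ ≤ ∣ T ∣

  CycSub : Fin n → Fin n → Set
  CycSub g h = ∀ a → InCyc g a → InCyc h a

  IsMaxCyc : Fin n → Set
  IsMaxCyc g = ∀ h → CycSub g h → CycSub h g

  InUniqueMaxCyc : Fin n → Set
  InUniqueMaxCyc x = ∃ λ g → (IsMaxCyc g × InCyc g x)
    × (∀ h → IsMaxCyc h → InCyc h x → CycSub h g × CycSub g h)

module Submission where

-- In a nilpotent group, elements a, b of coprime orders u, v commute: by induction on the class, in
-- G/Z(G) one has ab = z·ba with z central, and then z^u = z^v = e, so z = e. Now let x = x₁⋯x_r with
-- x_k = e. The other components have orders prime to p_k, so x has an exponent L coprime to |P_k|, and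
-- every z ∈ P_k (whose order divides |P_k| by Lagrange) commutes with x. Hence x is a power of xz, so a
-- maximal cyclic subgroup containing xz contains x and is therefore the unique one, ⟨g⟩. Thus
-- z = x⁻¹(xz) ∈ ⟨g⟩, and P_k, a subgroup of the cyclic group ⟨g⟩, is cyclic.

open import Level using (_⊔_; Lift; lift; lower)
open import Algebra.Bundles using (Group)
open import Data.Nat.Base using (ℕ; zero; suc; _+_; _*_)
open import Data.Nat.Coprimality using (Coprime; coprime-Bézout)
open import Data.Nat.GCD using (module Bézout)
open import Data.Product using (∃-syntax; _×_; _,_)
open import Relation.Binary.Core using (Rel)
import Relation.Binary.PropositionalEquality as ≡

module GroupTheory {c ℓ} (G : Group c ℓ) where
  open Group G
  open import Algebra.Properties.Group G
  import Algebra.Properties.Monoid.Mult monoid as Mult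
  open import Relation.Binary.Reasoning.Setoid setoid

  infixr 8 _^_
  _^_ : Carrier → ℕ → Carrier
  x ^ n = n Mult.× x

  ^-cong : ∀ n {x y} → x ≈ y → x ^ n ≈ y ^ n
  ^-cong = Mult.×-congʳ

  ^-+ : ∀ x m n → x ^ (m + n) ≈ x ^ m ∙ x ^ n
  ^-+ = Mult.×-homo-+

  ^-* : ∀ x m n → x ^ (m * n) ≈ (x ^ n) ^ m
  ^-* x m n = sym (Mult.×-assocˡ x m n)

  ε^ : ∀ n → ε ^ n ≈ ε
  ε^ zero    = refl
  ε^ (suc n) = trans (identityˡ _) (ε^ n)

  ^≈ε⇒^*≈ε : ∀ {x n} m → x ^ n ≈ ε → x ^ (m * n) ≈ ε
  ^≈ε⇒^*≈ε {x} {n} m xⁿ≈ε = trans (^-* x m n) (trans (^-cong m xⁿ≈ε) (ε^ m))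

  ^≈ε-Bézout : ∀ {x m k} a b → x ^ m ≈ ε → x ^ k ≈ ε → 1 + b * m ≡.≡ a * k → x ≈ ε
  ^≈ε-Bézout {x} {m} {k} a b xᵐ≈ε xᵏ≈ε eq = begin
    x                ≈⟨ identityʳ x ⟨
    x ∙ ε            ≈⟨ ∙-congˡ (^≈ε⇒^*≈ε b xᵐ≈ε) ⟨
    x ^ (1 + b * m)  ≡⟨ ≡.cong (x ^_) eq ⟩
    x ^ (a * k)      ≈⟨ ^≈ε⇒^*≈ε a xᵏ≈ε ⟩
    ε                ∎

  coprime-^≈ε⇒≈ε : ∀ {x u v} → Coprime u v → x ^ u ≈ ε → x ^ v ≈ ε → x ≈ ε
  coprime-^≈ε⇒≈ε u⊥v xᵘ≈ε xᵛ≈ε with coprime-Bézout u⊥v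
  ... | Bézout.+- a b eq = ^≈ε-Bézout a b xᵛ≈ε xᵘ≈ε eq
  ... | Bézout.-+ a b eq = ^≈ε-Bézout b a xᵘ≈ε xᵛ≈ε eq

  Commute : Carrier → Carrier → Set ℓ
  Commute a b = a ∙ b ≈ b ∙ a

  commute-ε : ∀ {a} → Commute a ε
  commute-ε {a} = trans (identityʳ a) (sym (identityˡ a))

  commute-∙ : ∀ {a b c} → Commute a b → Commute a c → Commute a (b ∙ c)
  commute-∙ {a} {b} {c} ab≈ba ac≈ca = begin
    a ∙ (b ∙ c)  ≈⟨ assoc a b c ⟨
    a ∙ b ∙ c    ≈⟨ ∙-congʳ ab≈ba ⟩
    b ∙ a ∙ c    ≈⟨ assoc b a c ⟩
    b ∙ (a ∙ c)  ≈⟨ ∙-congˡ ac≈ca ⟩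
    b ∙ (c ∙ a)  ≈⟨ assoc b c a ⟨
    b ∙ c ∙ a    ∎

  commute-^ : ∀ {a b} n → Commute a b → Commute a (b ^ n)
  commute-^ zero    _     = commute-ε
  commute-^ (suc n) ab≈ba = commute-∙ ab≈ba (commute-^ n ab≈ba)

  ^-distrib-∙ : ∀ {a b} n → Commute a b → (a ∙ b) ^ n ≈ a ^ n ∙ b ^ n
  ^-distrib-∙ zero    _ = sym (identityˡ ε)
  ^-distrib-∙ {a} {b} (suc n) ab≈ba = begin
    a ∙ b ∙ (a ∙ b) ^ n        ≈⟨ ∙-congˡ (^-distrib-∙ n ab≈ba) ⟩
    a ∙ b ∙ (a ^ n ∙ b ^ n)    ≈⟨ assoc a b _ ⟩
    a ∙ (b ∙ (a ^ n ∙ b ^ n))  ≈⟨ ∙-congˡ (assoc b _ _) ⟨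
    a ∙ (b ∙ a ^ n ∙ b ^ n)    ≈⟨ ∙-congˡ (∙-congʳ (commute-^ n (sym ab≈ba))) ⟩
    a ∙ (a ^ n ∙ b ∙ b ^ n)    ≈⟨ ∙-congˡ (assoc _ b _) ⟩
    a ∙ (a ^ n ∙ (b ∙ b ^ n))  ≈⟨ assoc a _ _ ⟨
    a ∙ a ^ n ∙ (b ∙ b ^ n)    ∎

  Central : Carrier → Set (c ⊔ ℓ)
  Central z = ∀ g → Commute z g

  central-ε : Central ε
  central-ε g = sym commute-ε

  central-∙ : ∀ {y z} → Central y → Central z → Central (y ∙ z)
  central-∙ {y} {z} y-central z-central g = begin
    y ∙ z ∙ g    ≈⟨ assoc y z g ⟩
    y ∙ (z ∙ g)  ≈⟨ ∙-congˡ (z-central g) ⟩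
    y ∙ (g ∙ z)  ≈⟨ assoc y g z ⟨
    y ∙ g ∙ z    ≈⟨ ∙-congʳ (y-central g) ⟩
    g ∙ y ∙ z    ≈⟨ assoc g y z ⟩
    g ∙ (y ∙ z)  ∎

  central-⁻¹ : ∀ {z} → Central z → Central (z ⁻¹)
  central-⁻¹ {z} z-central g = ∙-cancelˡ z _ _ (begin
    z ∙ (z ⁻¹ ∙ g)  ≈⟨ assoc z _ g ⟨
    z ∙ z ⁻¹ ∙ g    ≈⟨ ∙-congʳ (inverseʳ z) ⟩
    ε ∙ g           ≈⟨ central-ε g ⟩
    g ∙ ε           ≈⟨ ∙-congˡ (inverseʳ z) ⟨
    g ∙ (z ∙ z ⁻¹)  ≈⟨ assoc g z _ ⟨
    g ∙ z ∙ z ⁻¹    ≈⟨ ∙-congʳ (z-central g) ⟨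
    z ∙ g ∙ z ⁻¹    ≈⟨ assoc z g _ ⟩
    z ∙ (g ∙ z ⁻¹)  ∎)

  central-^ : ∀ {z} n → Central z → Central (z ^ n)
  central-^ n z-central g = sym (commute-^ n (sym (z-central g)))

  twisted-commute-^ : ∀ {t x z} → Central z → t ∙ x ≈ z ∙ (x ∙ t) →
                      ∀ n → t ∙ x ^ n ≈ z ^ n ∙ (x ^ n ∙ t)
  twisted-commute-^ {t} _ _ zero = trans (identityʳ t) (sym (trans (identityˡ _) (identityˡ t)))
  twisted-commute-^ {t} {x} {z} z-central tx≈zxt (suc n) = begin
    t ∙ (x ∙ x ^ n)                  ≈⟨ assoc t x _ ⟨
    t ∙ x ∙ x ^ n                    ≈⟨ ∙-congʳ tx≈zxt ⟩
    z ∙ (x ∙ t) ∙ x ^ n              ≈⟨ assoc z _ _ ⟩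
    z ∙ (x ∙ t ∙ x ^ n)              ≈⟨ ∙-congˡ (assoc x t _) ⟩
    z ∙ (x ∙ (t ∙ x ^ n))            ≈⟨ ∙-congˡ (∙-congˡ (twisted-commute-^ z-central tx≈zxt n)) ⟩
    z ∙ (x ∙ (z ^ n ∙ (x ^ n ∙ t)))  ≈⟨ ∙-congˡ (assoc x _ _) ⟨
    z ∙ (x ∙ z ^ n ∙ (x ^ n ∙ t))    ≈⟨ ∙-congˡ (∙-congʳ (central-^ n z-central x)) ⟨
    z ∙ (z ^ n ∙ x ∙ (x ^ n ∙ t))    ≈⟨ ∙-congˡ (assoc _ x _) ⟩
    z ∙ (z ^ n ∙ (x ∙ (x ^ n ∙ t)))  ≈⟨ assoc z _ _ ⟨
    z ∙ z ^ n ∙ (x ∙ (x ^ n ∙ t))    ≈⟨ ∙-congˡ (assoc x _ t) ⟨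
    z ∙ z ^ n ∙ (x ∙ x ^ n ∙ t)      ∎

  twisted-commute-^≈ε : ∀ {t x z n} → Central z → t ∙ x ≈ z ∙ (x ∙ t) → x ^ n ≈ ε → z ^ n ≈ ε
  twisted-commute-^≈ε {t} {x} {z} {n} z-central tx≈zxt xⁿ≈ε = identityˡ-unique _ t (sym (begin
    t                    ≈⟨ identityʳ t ⟨
    t ∙ ε                ≈⟨ ∙-congˡ xⁿ≈ε ⟨
    t ∙ x ^ n            ≈⟨ twisted-commute-^ z-central tx≈zxt n ⟩
    z ^ n ∙ (x ^ n ∙ t)  ≈⟨ ∙-congˡ (trans (∙-congʳ xⁿ≈ε) (identityˡ t)) ⟩
    z ^ n ∙ t            ∎))

  twisted-commute-⁻¹ : ∀ {t x z} → Central z → t ∙ x ≈ z ∙ (x ∙ t) → x ⁻¹ ∙ t ≈ z ∙ (t ∙ x ⁻¹)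
  twisted-commute-⁻¹ {t} {x} {z} z-central tx≈zxt = begin
    x ⁻¹ ∙ t                      ≈⟨ identityʳ _ ⟨
    x ⁻¹ ∙ t ∙ ε                  ≈⟨ ∙-congˡ (inverseʳ x) ⟨
    x ⁻¹ ∙ t ∙ (x ∙ x ⁻¹)         ≈⟨ assoc _ x _ ⟨
    x ⁻¹ ∙ t ∙ x ∙ x ⁻¹           ≈⟨ ∙-congʳ (assoc _ t x) ⟩
    x ⁻¹ ∙ (t ∙ x) ∙ x ⁻¹         ≈⟨ ∙-congʳ (∙-congˡ tx≈zxt) ⟩
    x ⁻¹ ∙ (z ∙ (x ∙ t)) ∙ x ⁻¹   ≈⟨ ∙-congʳ (assoc _ z _) ⟨
    x ⁻¹ ∙ z ∙ (x ∙ t) ∙ x ⁻¹     ≈⟨ ∙-congʳ (∙-congʳ (z-central _)) ⟨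
    z ∙ x ⁻¹ ∙ (x ∙ t) ∙ x ⁻¹     ≈⟨ ∙-congʳ (assoc z _ _) ⟩
    z ∙ (x ⁻¹ ∙ (x ∙ t)) ∙ x ⁻¹   ≈⟨ ∙-congʳ (∙-congˡ (assoc _ x t)) ⟨
    z ∙ (x ⁻¹ ∙ x ∙ t) ∙ x ⁻¹     ≈⟨ ∙-congʳ (∙-congˡ (trans (∙-congʳ (inverseˡ x)) (identityˡ t))) ⟩
    z ∙ t ∙ x ⁻¹                  ≈⟨ assoc z t _ ⟩
    z ∙ (t ∙ x ⁻¹)                ∎

  -- Congruence modulo the centre; centralQuotient below is G/Z(G) on the carrier of G.
  infix 4 _≈ᶻ_
  _≈ᶻ_ : Rel Carrier (c ⊔ ℓ)
  x ≈ᶻ y = ∃[ z ] Central z × x ≈ z ∙ y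

  ≈⇒≈ᶻ : ∀ {x y} → x ≈ y → x ≈ᶻ y
  ≈⇒≈ᶻ x≈y = ε , central-ε , trans x≈y (sym (identityˡ _))

  ≈ᶻ-sym : ∀ {x y} → x ≈ᶻ y → y ≈ᶻ x
  ≈ᶻ-sym {x} {y} (z , z-central , x≈zy) = z ⁻¹ , central-⁻¹ z-central , (begin
    y              ≈⟨ identityˡ y ⟨
    ε ∙ y          ≈⟨ ∙-congʳ (inverseˡ z) ⟨
    z ⁻¹ ∙ z ∙ y   ≈⟨ assoc _ z y ⟩
    z ⁻¹ ∙ (z ∙ y) ≈⟨ ∙-congˡ x≈zy ⟨
    z ⁻¹ ∙ x       ∎)

  ≈ᶻ-trans : ∀ {x y w} → x ≈ᶻ y → y ≈ᶻ w → x ≈ᶻ w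
  ≈ᶻ-trans {x} {y} {w} (z , z-central , x≈zy) (z′ , z′-central , y≈z′w) =
    z ∙ z′ , central-∙ z-central z′-central , (begin
      x             ≈⟨ x≈zy ⟩
      z ∙ y         ≈⟨ ∙-congˡ y≈z′w ⟩
      z ∙ (z′ ∙ w)  ≈⟨ assoc z z′ w ⟨
      z ∙ z′ ∙ w    ∎)

  ≈ᶻ-∙-cong : ∀ {x y u w} → x ≈ᶻ y → u ≈ᶻ w → x ∙ u ≈ᶻ y ∙ w
  ≈ᶻ-∙-cong {x} {y} {u} {w} (z , z-central , x≈zy) (z′ , z′-central , u≈z′w) =
    z ∙ z′ , central-∙ z-central z′-central , (begin
      x ∙ u               ≈⟨ ∙-cong x≈zy u≈z′w ⟩
      z ∙ y ∙ (z′ ∙ w)    ≈⟨ assoc z y _ ⟩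
      z ∙ (y ∙ (z′ ∙ w))  ≈⟨ ∙-congˡ (assoc y z′ w) ⟨
      z ∙ (y ∙ z′ ∙ w)    ≈⟨ ∙-congˡ (∙-congʳ (z′-central y)) ⟨
      z ∙ (z′ ∙ y ∙ w)    ≈⟨ ∙-congˡ (assoc z′ y w) ⟩
      z ∙ (z′ ∙ (y ∙ w))  ≈⟨ assoc z z′ _ ⟨
      z ∙ z′ ∙ (y ∙ w)    ∎)

  ≈ᶻ-⁻¹-cong : ∀ {x y} → x ≈ᶻ y → x ⁻¹ ≈ᶻ y ⁻¹
  ≈ᶻ-⁻¹-cong {x} {y} (z , z-central , x≈zy) = z ⁻¹ , central-⁻¹ z-central , (begin
    x ⁻¹           ≈⟨ ⁻¹-cong x≈zy ⟩
    (z ∙ y) ⁻¹     ≈⟨ ⁻¹-anti-homo-∙ z y ⟩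
    y ⁻¹ ∙ z ⁻¹    ≈⟨ central-⁻¹ z-central (y ⁻¹) ⟨
    z ⁻¹ ∙ y ⁻¹    ∎)

  centralQuotient : Group c (c ⊔ ℓ)
  centralQuotient = record
    { Carrier = Carrier ; _≈_ = _≈ᶻ_ ; _∙_ = _∙_ ; ε = ε ; _⁻¹ = _⁻¹
    ; isGroup = record
      { isMonoid = record
        { isSemigroup = record
          { isMagma = record
            { isEquivalence = record { refl = ≈⇒≈ᶻ refl ; sym = ≈ᶻ-sym ; trans = ≈ᶻ-trans }
            ; ∙-cong = ≈ᶻ-∙-cong
            }
          ; assoc = λ x y z → ≈⇒≈ᶻ (assoc x y z)
          }
        ; identity = (λ x → ≈⇒≈ᶻ (identityˡ x)) , (λ x → ≈⇒≈ᶻ (identityʳ x))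
        }
      ; inverse = (λ x → ≈⇒≈ᶻ (inverseˡ x)) , (λ x → ≈⇒≈ᶻ (inverseʳ x))
      ; ⁻¹-cong = ≈ᶻ-⁻¹-cong
      }
    }

  commutator : Carrier → Carrier → Carrier
  commutator g h = g ⁻¹ ∙ h ⁻¹ ∙ g ∙ h

  commutator≈ε⇒commute : ∀ g h → commutator g h ≈ ε → Commute g h
  commutator≈ε⇒commute g h [g,h]≈ε = ⁻¹-injective (begin
    (g ∙ h) ⁻¹     ≈⟨ inverseˡ-unique (g ⁻¹ ∙ h ⁻¹) (g ∙ h) (trans (sym (assoc _ g h)) [g,h]≈ε) ⟨
    g ⁻¹ ∙ h ⁻¹    ≈⟨ ⁻¹-anti-homo-∙ h g ⟨
    (h ∙ g) ⁻¹     ∎)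

  UpperCentral : ℕ → Carrier → Set (c ⊔ ℓ)
  UpperCentral zero    g = Lift c (g ≈ ε)
  UpperCentral (suc i) g = ∀ h → UpperCentral i (commutator g h)

module CentralQuotient {c ℓ} (G : Group c ℓ) where
  open Group G
  open GroupTheory G
  module Q = GroupTheory centralQuotient

  upperCentral-suc⇒quotient : ∀ i {g} → UpperCentral (suc i) g → Q.UpperCentral i g
  upperCentral-suc⇒quotient zero {g} g∈Z₁ =
    lift (g , (λ h → commutator≈ε⇒commute g h (lower (g∈Z₁ h))) , sym (identityʳ g))
  upperCentral-suc⇒quotient (suc i) g∈Zᵢ₊₂ h = upperCentral-suc⇒quotient i (g∈Zᵢ₊₂ h)

  ^-quotient : ∀ x n → x Q.^ n ≡.≡ x ^ n
  ^-quotient x zero    = ≡.refl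
  ^-quotient x (suc n) = ≡.cong (x ∙_) (^-quotient x n)

  ^≈ε⇒quotient : ∀ {x n} → x ^ n ≈ ε → x Q.^ n ≈ᶻ ε
  ^≈ε⇒quotient {x} {n} xⁿ≈ε = ≡.subst (_≈ᶻ ε) (≡.sym (^-quotient x n)) (≈⇒≈ᶻ xⁿ≈ε)

coprime-orders-commute : ∀ N {c ℓ} (G : Group c ℓ) → let open Group G; open GroupTheory G in
  (∀ g → UpperCentral N g) → ∀ {a b u v} → Coprime u v → a ^ u ≈ ε → b ^ v ≈ ε → Commute a b
coprime-orders-commute zero G Z₀ {a} {b} _ _ _ =
  trans (∙-cong (lower (Z₀ a)) (lower (Z₀ b))) (sym (∙-cong (lower (Z₀ b)) (lower (Z₀ a))))
  where open Group G
coprime-orders-commute (suc N) G Zₙ₊₁ {a} {b} {u} {v} u⊥v aᵘ≈ε bᵛ≈ε = ab≈ba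
  where
  open Group G
  open GroupTheory G
  open CentralQuotient G

  ab≈ᶻba : a ∙ b ≈ᶻ b ∙ a
  ab≈ᶻba = coprime-orders-commute N centralQuotient
    (λ g → upperCentral-suc⇒quotient N (Zₙ₊₁ g)) u⊥v (^≈ε⇒quotient {a} {u} aᵘ≈ε) (^≈ε⇒quotient {b} {v} bᵛ≈ε)

  ab≈ba : Commute a b
  ab≈ba with ab≈ᶻba
  ... | z , z-central , ab≈zba = trans ab≈zba (trans (∙-congʳ z≈ε) (identityˡ _))
    where
    z≈ε : z ≈ ε
    z≈ε = coprime-^≈ε⇒≈ε u⊥v
      (twisted-commute-^≈ε {n = u} z-central (twisted-commute-⁻¹ z-central ab≈zba) aᵘ≈ε)
      (twisted-commute-^≈ε {n = v} z-central ab≈zba bᵛ≈ε)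

open import Level using (0ℓ)
open import Data.Bool.Base using (true; false)
open import Data.Empty using (⊥-elim)
open import Data.Fin.Base using (Fin; zero; suc; toℕ; fromℕ<)
open import Data.Fin.Properties using (_≟_; any?; all?; pigeonhole; toℕ-injective; toℕ<n; toℕ-fromℕ<)
import Data.Fin.Properties as Finₚ
open import Data.Fin.Subset using (Subset; _∈_; _∉_; _⊆_; _⊂_; _∪_; _─_; ⁅_⁆; ∣_∣; inside; outside)
  renaming (⊥ to ∅)
open import Data.Fin.Subset.Induction using (⊂-wellFounded; Acc; acc)
open import Data.Fin.Subset.Properties
  using (_∈?_; ∣⊥∣≡0; nonempty?; Empty-unique; drop-∷-⊆; ∪-identityˡ; x∈⁅x⁆; x∈⁅y⁆⇒x≡y; ∉⊥;
         x∈p∪q⁺; x∈p∪q⁻; x∈p∩q⁺; x∈p∧x∉q⇒x∈p─q; p─q⊆p; p∩q≢∅⇒p─q⊂p)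
open import Data.Nat.Base using (_∸_; _<_; _≤_; s≤s; z≤n; NonZero; _%_; _/_)
open import Data.Nat.Properties
  using (m<1+n⇒m<n∨m≡n; n<1+n; +-suc; m+[n∸m]≡n; m<n⇒0<n∸m; <⇒≤; <-cmp; m∸n≤m; ≤-<-trans; *-suc; _<?_)
open import Data.Nat.Coprimality using (coprime-divisor; 1-coprimeTo)
import Data.Nat.Coprimality as Coprimality
open import Data.Nat.DivMod using (m≡m%n+[m/n]*n; m%n<n)
open import Data.Nat.Divisibility
  using (_∣_; divides; _∣0; ∣-refl; ∣-reflexive; ∣-trans; ∣m⇒∣m*n; ∣n⇒∣m*n; ∣m∣n⇒∣m+n)
open import Data.Product using (proj₁; proj₂)
open import Data.Sum using (_⊎_; inj₁; inj₂; [_,_]′)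
open import Data.Vec.Base using (_∷_; []; tabulate; here; there)
open import Data.Vec.Properties using (lookup⇒[]=; []=⇒lookup; lookup∘tabulate)
open import Function.Base using (id; _∘_)
open import Function.Definitions using (Injective)
open import Relation.Binary.Definitions using (tri<; tri≈; tri>)
open import Relation.Nullary using (¬_; Dec; yes; no; does; ¬?)
open import Relation.Nullary.Decidable using (dec-true; dec-false; decidable-stable; map′; _×-dec_; _→-dec_)
open import Relation.Unary using (Pred; Decidable)
open ≡ using (_≡_; _≢_; refl; cong; sym; trans)

open import Defs

minimal : ∀ {p} {P : Pred ℕ p} → Decidable P → ∀ {m} → P m → ∃[ k ] P k × (∀ {j} → j < k → ¬ P j)
minimal {P = P} P? {m} pₘ with search (suc m)
  where
  search : ∀ b → (∃[ k ] P k × (∀ {j} → j < k → ¬ P j)) ⊎ (∀ {j} → j < b → ¬ P j)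
  search zero = inj₂ λ ()
  search (suc b) with search b
  ... | inj₁ found = inj₁ found
  ... | inj₂ none with P? b
  ...   | yes p_b = inj₁ (b , p_b , none)
  ...   | no ¬p_b = inj₂ λ j<1+b → [ none , (λ { refl → ¬p_b }) ]′ (m<1+n⇒m<n∨m≡n j<1+b)
... | inj₁ found = found
... | inj₂ none  = ⊥-elim (none (n<1+n m) pₘ)

∣p∣≡∣p─q∣+∣q∣ : ∀ {m} {p q : Subset m} → q ⊆ p → ∣ p ∣ ≡ ∣ p ─ q ∣ + ∣ q ∣
∣p∣≡∣p─q∣+∣q∣ {p = []}          {[]}          _   = refl
∣p∣≡∣p─q∣+∣q∣ {p = outside ∷ p} {outside ∷ q} q⊆p = ∣p∣≡∣p─q∣+∣q∣ (drop-∷-⊆ q⊆p)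
∣p∣≡∣p─q∣+∣q∣ {p = inside  ∷ p} {outside ∷ q} q⊆p = cong suc (∣p∣≡∣p─q∣+∣q∣ (drop-∷-⊆ q⊆p))
∣p∣≡∣p─q∣+∣q∣ {p = inside  ∷ p} {inside  ∷ q} q⊆p =
  trans (cong suc (∣p∣≡∣p─q∣+∣q∣ (drop-∷-⊆ q⊆p))) (sym (+-suc ∣ p ─ q ∣ ∣ q ∣))
∣p∣≡∣p─q∣+∣q∣ {p = outside ∷ p} {inside  ∷ q} q⊆p with q⊆p here
... | ()

x∈p─q⇒x∉q : ∀ {m} {x : Fin m} (p q : Subset m) → x ∈ p ─ q → x ∉ q
x∈p─q⇒x∉q (_ ∷ p) (_ ∷ q) (there x∈p─q) (there x∈q) = x∈p─q⇒x∉q p q x∈p─q x∈q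

∣⁅x⁆∪p∣≡1+∣p∣ : ∀ {m} (x : Fin m) (p : Subset m) → x ∉ p → ∣ ⁅ x ⁆ ∪ p ∣ ≡ suc ∣ p ∣
∣⁅x⁆∪p∣≡1+∣p∣ zero    (outside ∷ p) _   = cong (λ q → suc ∣ q ∣) (∪-identityˡ p)
∣⁅x⁆∪p∣≡1+∣p∣ zero    (inside  ∷ p) x∉p = ⊥-elim (x∉p here)
∣⁅x⁆∪p∣≡1+∣p∣ (suc x) (outside ∷ p) x∉p = ∣⁅x⁆∪p∣≡1+∣p∣ x p (x∉p ∘ there)
∣⁅x⁆∪p∣≡1+∣p∣ (suc x) (inside  ∷ p) x∉p = cong suc (∣⁅x⁆∪p∣≡1+∣p∣ x p (x∉p ∘ there))

image : ∀ {d m} → (Fin d → Fin m) → Subset m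
image {zero}  f = ∅
image {suc d} f = ⁅ f zero ⁆ ∪ image (λ j → f (suc j))

∈-image⁺ : ∀ {d m} (f : Fin d → Fin m) j → f j ∈ image f
∈-image⁺ f zero    = x∈p∪q⁺ (inj₁ (x∈⁅x⁆ (f zero)))
∈-image⁺ f (suc j) = x∈p∪q⁺ (inj₂ (∈-image⁺ (λ i → f (suc i)) j))

∈-image⁻ : ∀ {d m} (f : Fin d → Fin m) {y} → y ∈ image f → ∃[ j ] f j ≡ y
∈-image⁻ {zero}  f y∈∅ = ⊥-elim (∉⊥ y∈∅)
∈-image⁻ {suc d} f y∈image with x∈p∪q⁻ ⁅ f zero ⁆ (image (λ j → f (suc j))) y∈image
... | inj₁ y∈⁅f0⁆ = zero , sym (x∈⁅y⁆⇒x≡y (f zero) y∈⁅f0⁆)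
... | inj₂ y∈rest with ∈-image⁻ (λ j → f (suc j)) y∈rest
...   | j , fj≡y = suc j , fj≡y

∣image∣ : ∀ {d m} (f : Fin d → Fin m) → Injective _≡_ _≡_ f → ∣ image f ∣ ≡ d
∣image∣ {zero}  {m} f _ = ∣⊥∣≡0 m
∣image∣ {suc d} f f-inj = trans
  (∣⁅x⁆∪p∣≡1+∣p∣ (f zero) (image (λ j → f (suc j))) f0∉rest)
  (cong suc (∣image∣ (λ j → f (suc j)) (λ eq → Finₚ.suc-injective (f-inj eq))))
  where
  f0∉rest : f zero ∉ image (λ j → f (suc j))
  f0∉rest f0∈rest with ∈-image⁻ (λ j → f (suc j)) f0∈rest
  ... | j , fj≡f0 with f-inj fj≡f0
  ... | ()

module _ {m r} {R : Rel (Fin m) r} (R? : ∀ x y → Dec (R x y))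
         (R-refl : ∀ {x} → R x x) (R-trans : ∀ {x y z} → R x y → R y z → R x z) where

  private
    above : Fin m → Subset m
    above x = tabulate (λ z → does (R? x z))

    ∈-above⁺ : ∀ {x z} → R x z → z ∈ above x
    ∈-above⁺ {x} {z} xRz = lookup⇒[]= z (above x) (trans (lookup∘tabulate _ z) (dec-true (R? x z) xRz))

    ∈-above⁻ : ∀ {x z} → z ∈ above x → R x z
    ∈-above⁻ {x} {z} z∈above = decidable-stable (R? x z) λ ¬xRz →
      true≢false (trans (sym ([]=⇒lookup z∈above)) (trans (lookup∘tabulate _ z) (dec-false (R? x z) ¬xRz)))
      where
      true≢false : true ≢ false
      true≢false ()

  maximal-above : ∀ x → ∃[ y ] R x y × (∀ z → R y z → R z y)
  maximal-above x = go x (⊂-wellFounded (above x))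
    where
    go : ∀ x → Acc _⊂_ (above x) → ∃[ y ] R x y × (∀ z → R y z → R z y)
    go x (acc rec) with any? (λ z → R? x z ×-dec ¬? (R? z x))
    ... | no ¬bigger = x , R-refl , λ z xRz → decidable-stable (R? z x) (λ ¬zRx → ¬bigger (z , xRz , ¬zRx))
    ... | yes (z , xRz , ¬zRx) with go z (rec above-z⊂above-x)
      where
      above-z⊂above-x : above z ⊂ above x
      above-z⊂above-x = (λ w∈ → ∈-above⁺ (R-trans xRz (∈-above⁻ w∈))) , x , ∈-above⁺ R-refl , ¬zRx ∘ ∈-above⁻
    ...   | y , zRy , y-maximal = y , R-trans xRz zRy , y-maximal

coprime-* : ∀ {m k l} → Coprime m k → Coprime m l → Coprime m (k * l)
coprime-* {m} {k} m⊥k m⊥l {d} (d∣m , d∣kl) = m⊥l (d∣m , coprime-divisor d⊥k d∣kl)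
  where
  d⊥k : Coprime d k
  d⊥k (e∣d , e∣k) = m⊥k (∣-trans e∣d d∣m , e∣k)

coprime-∏ : ∀ {m r} (f : Fin r → ℕ) → (∀ i → Coprime m (f i)) → Coprime m (∏ f)
coprime-∏ {m} {zero}  f _     = Coprimality.sym (1-coprimeTo m)
coprime-∏ {r = suc r} f m⊥f = coprime-* (m⊥f zero) (coprime-∏ (f ∘ suc) (m⊥f ∘ suc))

∣∏ : ∀ {r} (f : Fin r → ℕ) i → f i ∣ ∏ f
∣∏ f zero    = ∣m⇒∣m*n _ ∣-refl
∣∏ f (suc i) = ∣n⇒∣m*n (f zero) (∣∏ (f ∘ suc) i)

module FiniteGroup {n : ℕ} (G : FinGroup n) where
  open FinGroup G
  open ≡.≡-Reasoning

  group : Group 0ℓ 0ℓ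
  group = record { Carrier = Fin n ; _≈_ = _≡_ ; _∙_ = _∙_ ; ε = ε ; _⁻¹ = _⁻¹ ; isGroup = isGroup }

  open Group group using (assoc; identityˡ; identityʳ; inverseʳ)
  open import Algebra.Properties.Group group
    using (∙-cancelˡ; x≈z//y; \\-leftDividesʳ; identityʳ-unique; inverseʳ-unique; ⁻¹-involutive)
  open GroupTheory group
    using (_^_; ^-+; ^-*; ε^; ^≈ε⇒^*≈ε; ^-distrib-∙; commute-ε; commute-∙; commute-^; UpperCentral)

  pow≡^ : ∀ g m → pow g m ≡ g ^ m
  pow≡^ g zero    = refl
  pow≡^ g (suc m) = cong (g ∙_) (pow≡^ g m)

  pow-+ : ∀ g m k → pow g (m + k) ≡ pow g m ∙ pow g k
  pow-+ g m k rewrite pow≡^ g (m + k) | pow≡^ g m | pow≡^ g k = ^-+ g m k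

  pow-* : ∀ g m k → pow g (m * k) ≡ pow (pow g k) m
  pow-* g m k rewrite pow≡^ (pow g k) m | pow≡^ g k | pow≡^ g (m * k) = ^-* g m k

  pow≡ε⇒pow*≡ε : ∀ {g k} m → pow g k ≡ ε → pow g (m * k) ≡ ε
  pow≡ε⇒pow*≡ε {g} {k} m gᵏ≡ε rewrite pow≡^ g (m * k) | pow≡^ g k = ^≈ε⇒^*≈ε m gᵏ≡ε

  pow≡ε-∣ : ∀ {g k m} → k ∣ m → pow g k ≡ ε → pow g m ≡ ε
  pow≡ε-∣ (divides q refl) gᵏ≡ε = pow≡ε⇒pow*≡ε q gᵏ≡ε

  pow-ε : ∀ m → pow ε m ≡ ε
  pow-ε m rewrite pow≡^ ε m = ε^ m

  pow-distrib : ∀ {a b} m → a ∙ b ≡ b ∙ a → pow (a ∙ b) m ≡ pow a m ∙ pow b m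
  pow-distrib {a} {b} m ab≡ba rewrite pow≡^ (a ∙ b) m | pow≡^ a m | pow≡^ b m = ^-distrib-∙ m ab≡ba

  pow-sucʳ : ∀ g m → pow g (suc m) ≡ pow g m ∙ g
  pow-sucʳ g m rewrite pow≡^ g m = commute-^ m refl

  pow≡pow⇒pow∸≡ε : ∀ a {i j} → i ≤ j → pow a i ≡ pow a j → pow a (j ∸ i) ≡ ε
  pow≡pow⇒pow∸≡ε a {i} {j} i≤j aⁱ≡aʲ = identityʳ-unique (pow a i) _ (begin
    pow a i ∙ pow a (j ∸ i)  ≡⟨ pow-+ a i (j ∸ i) ⟨
    pow a (i + (j ∸ i))      ≡⟨ cong (pow a) (m+[n∸m]≡n i≤j) ⟩
    pow a j                  ≡⟨ aⁱ≡aʲ ⟨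
    pow a i                  ∎)

  IsOrder : Fin n → ℕ → Set
  IsOrder a d = pow a d ≡ ε × (∀ {j} → 0 < j → j < d → pow a j ≢ ε)

  order : ∀ a → ∃[ k ] IsOrder a (suc k)
  order a with pigeonhole (n<1+n n) (λ (j : Fin (suc n)) → pow a (toℕ j))
  ... | i , j , i<j , aⁱ≡aʲ
    with minimal (λ m → (0 <? m) ×-dec (pow a m ≟ ε))
                 (m<n⇒0<n∸m i<j , pow≡pow⇒pow∸≡ε a (<⇒≤ i<j) aⁱ≡aʲ)
  ... | suc k , (_ , aᵈ≡ε) , below = k , aᵈ≡ε , λ 0<j j<d aʲ≡ε → below j<d (0<j , aʲ≡ε)

  pow-distinct : ∀ {a d i j} → IsOrder a d → i < j → j < d → pow a i ≢ pow a j
  pow-distinct {a} {d} {i} {j} (_ , below) i<j j<d =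
    below (m<n⇒0<n∸m i<j) (≤-<-trans (m∸n≤m j i) j<d) ∘ pow≡pow⇒pow∸≡ε a (<⇒≤ i<j)

  pow-injective : ∀ {a d} → IsOrder a d → Injective _≡_ _≡_ (λ (j : Fin d) → pow a (toℕ j))
  pow-injective ord {i} {j} aⁱ≡aʲ with <-cmp (toℕ i) (toℕ j)
  ... | tri< i<j _ _ = ⊥-elim (pow-distinct ord i<j (toℕ<n j) aⁱ≡aʲ)
  ... | tri≈ _ i≡j _ = toℕ-injective i≡j
  ... | tri> _ _ j<i = ⊥-elim (pow-distinct ord j<i (toℕ<n i) (sym aⁱ≡aʲ))

  pow-mod : ∀ {a} d .{{_ : NonZero d}} → pow a d ≡ ε → ∀ m → pow a m ≡ pow a (m % d)
  pow-mod {a} d aᵈ≡ε m = begin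
    pow a m                            ≡⟨ cong (pow a) (m≡m%n+[m/n]*n m d) ⟩
    pow a (m % d + m / d * d)          ≡⟨ pow-+ a (m % d) _ ⟩
    pow a (m % d) ∙ pow a (m / d * d)  ≡⟨ cong (pow a (m % d) ∙_) (pow≡ε⇒pow*≡ε (m / d) aᵈ≡ε) ⟩
    pow a (m % d) ∙ ε                  ≡⟨ identityʳ _ ⟩
    pow a (m % d)                      ∎

  inCyc-refl : ∀ g → InCyc g g
  inCyc-refl g = 1 , identityʳ g

  inCyc-trans : ∀ {g a b} → InCyc g a → InCyc a b → InCyc g b
  inCyc-trans {g} (i , gⁱ≡a) (j , aʲ≡b) = j * i , trans (pow-* g j i) (trans (cong (λ a → pow a j) gⁱ≡a) aʲ≡b)

  inCyc-∙ : ∀ {g a b} → InCyc g a → InCyc g b → InCyc g (a ∙ b)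
  inCyc-∙ {g} (i , gⁱ≡a) (j , gʲ≡b) = i + j , trans (pow-+ g i j) (≡.cong₂ _∙_ gⁱ≡a gʲ≡b)

  inCyc-⁻¹ : ∀ {g a} → InCyc g a → InCyc g (a ⁻¹)
  inCyc-⁻¹ {g} {a} (i , gⁱ≡a) with order g
  ... | k , gᵈ≡ε , _ = i * k , inverseʳ-unique a _ (begin
    a ∙ pow g (i * k)          ≡⟨ cong (_∙ pow g (i * k)) gⁱ≡a ⟨
    pow g i ∙ pow g (i * k)    ≡⟨ pow-+ g i (i * k) ⟨
    pow g (i + i * k)          ≡⟨ cong (pow g) (*-suc i k) ⟨
    pow g (i * suc k)          ≡⟨ pow≡ε⇒pow*≡ε i gᵈ≡ε ⟩
    ε                          ∎)

  InCyc? : ∀ g h → Dec (InCyc g h)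
  InCyc? g h with order g
  ... | k , gᵈ≡ε , _ = map′ (λ (j , gʲ≡h) → toℕ j , gʲ≡h) reduce
                            (any? λ (j : Fin (suc k)) → pow g (toℕ j) ≟ h)
    where
    reduce : InCyc g h → ∃[ j ] pow g (toℕ j) ≡ h
    reduce (m , gᵐ≡h) = fromℕ< (m%n<n m (suc k)) ,
      trans (cong (pow g) (toℕ-fromℕ< (m%n<n m (suc k)))) (trans (sym (pow-mod (suc k) gᵈ≡ε m)) gᵐ≡h)

  maximal-cyclic-above : ∀ w → ∃[ h ] CycSub w h × IsMaxCyc h
  maximal-cyclic-above =
    maximal-above (λ g h → all? λ a → InCyc? g a →-dec InCyc? h a) (λ _ → id) (λ g⊆h h⊆k a → h⊆k a ∘ g⊆h a)

  -- A set closed under right multiplication by a is a disjoint union of cosets h⟨a⟩, each of size ord a.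
  module Cosets {a k} (ord : IsOrder a (suc k)) where

    translate : Fin n → Fin (suc k) → Fin n
    translate h j = h ∙ pow a (toℕ j)

    coset : Fin n → Subset n
    coset h = image (translate h)

    ∣coset∣ : ∀ h → ∣ coset h ∣ ≡ suc k
    ∣coset∣ h = ∣image∣ (translate h) (λ eq → pow-injective ord (∙-cancelˡ h _ _ eq))

    ∈-coset⁺ : ∀ h m → h ∙ pow a m ∈ coset h
    ∈-coset⁺ h m = ≡.subst (_∈ coset h) (cong (h ∙_) aʲ≡aᵐ) (∈-image⁺ (translate h) j)
      where
      j = fromℕ< (m%n<n m (suc k))
      aʲ≡aᵐ : pow a (toℕ j) ≡ pow a m
      aʲ≡aᵐ = trans (cong (pow a) (toℕ-fromℕ< (m%n<n m (suc k)))) (sym (pow-mod (suc k) (proj₁ ord) m))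

    ∈-coset⁻ : ∀ {h y} → y ∈ coset h → ∃[ m ] h ∙ pow a m ≡ y
    ∈-coset⁻ {h} y∈ with ∈-image⁻ (translate h) y∈
    ... | j , eq = toℕ j , eq

    RightClosed : Subset n → Set
    RightClosed T = ∀ {y} → y ∈ T → y ∙ a ∈ T

    coset⊆ : ∀ {T h} → RightClosed T → h ∈ T → coset h ⊆ T
    coset⊆ {T} {h} closed h∈T y∈ with ∈-coset⁻ y∈
    ... | m , haᵐ≡y = ≡.subst (_∈ T) haᵐ≡y (haᵐ∈T m)
      where
      haᵐ∈T : ∀ m → h ∙ pow a m ∈ T
      haᵐ∈T zero    = ≡.subst (_∈ T) (sym (identityʳ h)) h∈T
      haᵐ∈T (suc m) = ≡.subst (_∈ T) (trans (assoc h _ a) (cong (h ∙_) (sym (pow-sucʳ a m)))) (closed (haᵐ∈T m))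

    coset-closed⁻ : ∀ {h y} → y ∙ a ∈ coset h → y ∈ coset h
    coset-closed⁻ {h} {y} ya∈ with ∈-coset⁻ ya∈
    ... | m , haᵐ≡ya = ≡.subst (_∈ coset h) haᵐ⁺ᵏ≡y (∈-coset⁺ h (m + k))
      where
      haᵐ⁺ᵏ≡y : h ∙ pow a (m + k) ≡ y
      haᵐ⁺ᵏ≡y = begin
        h ∙ pow a (m + k)          ≡⟨ cong (h ∙_) (pow-+ a m k) ⟩
        h ∙ (pow a m ∙ pow a k)    ≡⟨ assoc h _ _ ⟨
        h ∙ pow a m ∙ pow a k      ≡⟨ cong (_∙ pow a k) haᵐ≡ya ⟩
        y ∙ a ∙ pow a k            ≡⟨ assoc y a _ ⟩
        y ∙ pow a (suc k)          ≡⟨ cong (y ∙_) (proj₁ ord) ⟩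
        y ∙ ε                      ≡⟨ identityʳ y ⟩
        y                          ∎

    order∣∣T∣ : ∀ T → RightClosed T → suc k ∣ ∣ T ∣
    order∣∣T∣ T = go T (⊂-wellFounded T)
      where
      go : ∀ T → Acc _⊂_ T → RightClosed T → suc k ∣ ∣ T ∣
      go T (acc rec) closed with nonempty? T
      ... | no T-empty = ≡.subst (suc k ∣_) (sym (trans (cong ∣_∣ (Empty-unique T-empty)) (∣⊥∣≡0 n))) (suc k ∣0)
      ... | yes (h , h∈T) = ≡.subst (suc k ∣_) (sym (∣p∣≡∣p─q∣+∣q∣ (coset⊆ closed h∈T)))
              (∣m∣n⇒∣m+n (go (T ─ coset h) (rec T─coset⊂T) complement-closed)
                         (∣-reflexive (sym (∣coset∣ h))))
        where
        T─coset⊂T : T ─ coset h ⊂ T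
        T─coset⊂T =
          p∩q≢∅⇒p─q⊂p T (coset h) (h , x∈p∩q⁺ (h∈T , ≡.subst (_∈ coset h) (identityʳ h) (∈-coset⁺ h 0)))
        complement-closed : RightClosed (T ─ coset h)
        complement-closed y∈ =
          x∈p∧x∉q⇒x∈p─q (closed (p─q⊆p T (coset h) y∈)) (x∈p─q⇒x∉q T (coset h) y∈ ∘ coset-closed⁻)

  lagrange : ∀ {S} → IsSubgroup S → ∀ {a} → a ∈ S → pow a ∣ S ∣ ≡ ε
  lagrange {S} (_ , ∙-closed , _) {a} a∈S with order a
  ... | k , ord = pow≡ε-∣ (Cosets.order∣∣T∣ ord S (λ y∈S → ∙-closed y∈S a∈S)) (proj₁ ord)

  pow∈ : ∀ {S} → IsSubgroup S → ∀ {w} → w ∈ S → ∀ m → pow w m ∈ S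
  pow∈ (ε∈S , _ , _)          w∈S zero    = ε∈S
  pow∈ S-sub@(_ , ∙-closed , _) w∈S (suc m) = ∙-closed w∈S (pow∈ S-sub w∈S m)

  subgroup-of-cyclic : ∀ {S} → IsSubgroup S → ∀ g → (∀ h → h ∈ S → InCyc g h) → IsCyclicSub S
  subgroup-of-cyclic {S} S-sub@(ε∈S , ∙-closed , ⁻¹-closed) g S⊆⟨g⟩ with order g
  ... | k , gᵈ≡ε , _
    with minimal (λ m → (0 <? m) ×-dec (pow g m ∈? S)) {suc k} (s≤s z≤n , ≡.subst (_∈ S) (sym gᵈ≡ε) ε∈S)
  ... | suc m , (_ , w∈S) , below = w , w∈S , generates
    where
    w = pow g (suc m)

    no-smaller-exponent : ∀ r → r < suc m → pow g r ∈ S → r ≡ 0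
    no-smaller-exponent zero    _   _      = refl
    no-smaller-exponent (suc r) r<d gʳ∈S = ⊥-elim (below r<d (s≤s z≤n , gʳ∈S))

    generates : ∀ h → h ∈ S → InCyc w h
    generates h h∈S with S⊆⟨g⟩ h h∈S
    ... | j , gʲ≡h = j / suc m , sym h≡wᵠ
      where
      r = j % suc m
      q = j / suc m
      gʳwᵠ≡h : pow g r ∙ pow w q ≡ h
      gʳwᵠ≡h = begin
        pow g r ∙ pow w q           ≡⟨ cong (pow g r ∙_) (pow-* g q (suc m)) ⟨
        pow g r ∙ pow g (q * suc m) ≡⟨ pow-+ g r _ ⟨
        pow g (r + q * suc m)       ≡⟨ cong (pow g) (m≡m%n+[m/n]*n j (suc m)) ⟨
        pow g j                     ≡⟨ gʲ≡h ⟩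
        h                           ∎
      gʳ∈S : pow g r ∈ S
      gʳ∈S = ≡.subst (_∈ S) (sym (x≈z//y _ _ _ gʳwᵠ≡h)) (∙-closed h∈S (⁻¹-closed (pow∈ S-sub w∈S q)))
      h≡wᵠ : h ≡ pow w q
      h≡wᵠ = trans (sym gʳwᵠ≡h)
        (trans (cong (λ r → pow g r ∙ pow w q) (no-smaller-exponent r (m%n<n j (suc m)) gʳ∈S)) (identityˡ _))

  coprime-power-generates : ∀ {x u L} → Coprime u L → pow x L ≡ ε → InCyc (pow x u) x
  coprime-power-generates {x} {u} {L} u⊥L xᴸ≡ε with coprime-Bézout u⊥L
  ... | Bézout.+- a b 1+bL≡au = a , (begin
    pow (pow x u) a     ≡⟨ pow-* x a u ⟨
    pow x (a * u)       ≡⟨ cong (pow x) 1+bL≡au ⟨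
    x ∙ pow x (b * L)   ≡⟨ cong (x ∙_) (pow≡ε⇒pow*≡ε b xᴸ≡ε) ⟩
    x ∙ ε               ≡⟨ identityʳ x ⟩
    x                   ∎)
  ... | Bézout.-+ a b 1+au≡bL = ≡.subst (InCyc (pow x u)) (⁻¹-involutive x) (inCyc-⁻¹ (a , sym xaᵘ≡ε))
    where
    xaᵘ≡ε : x ⁻¹ ≡ pow (pow x u) a
    xaᵘ≡ε = sym (inverseʳ-unique x _ (begin
      x ∙ pow (pow x u) a  ≡⟨ cong (x ∙_) (pow-* x a u) ⟨
      pow x (1 + a * u)    ≡⟨ cong (pow x) 1+au≡bL ⟩
      pow x (b * L)        ≡⟨ pow≡ε⇒pow*≡ε b xᴸ≡ε ⟩
      ε                    ∎))

  upperCentral : ∀ i {g} → Zser i g → UpperCentral i g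
  upperCentral zero    g≡ε     = lift g≡ε
  upperCentral (suc i) g∈Zᵢ₊₁ h = upperCentral i (g∈Zᵢ₊₁ h)

  nilpotent⇒coprime-commute : IsNilpotent → ∀ {a b u v} → Coprime u v →
                              pow a u ≡ ε → pow b v ≡ ε → a ∙ b ≡ b ∙ a
  nilpotent⇒coprime-commute (c , Z) {a} {b} {u} {v} u⊥v aᵘ≡ε bᵛ≡ε =
    coprime-orders-commute c group (λ g → upperCentral c (Z g)) u⊥v
      (trans (sym (pow≡^ a u)) aᵘ≡ε) (trans (sym (pow≡^ b v)) bᵛ≡ε)

  commute-gprod : ∀ {r a} (ys : Fin r → Fin n) → (∀ i → a ∙ ys i ≡ ys i ∙ a) → a ∙ gprod ys ≡ gprod ys ∙ a
  commute-gprod {zero}  ys _         = commute-ε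
  commute-gprod {suc r} ys a-commutes =
    commute-∙ (a-commutes zero) (commute-gprod (ys ∘ suc) (a-commutes ∘ suc))

  gprod-pow≡ε : ∀ {r} L (ys : Fin r → Fin n) → (∀ i j → i ≢ j → ys i ∙ ys j ≡ ys j ∙ ys i) →
                (∀ i → pow (ys i) L ≡ ε) → pow (gprod ys) L ≡ ε
  gprod-pow≡ε {zero}  L ys _        _     = pow-ε L
  gprod-pow≡ε {suc r} L ys commuting ysᴸ≡ε =
    trans (pow-distrib L (commute-gprod (λ i → ys (suc i)) (λ i → commuting zero (suc i) 0≢suc)))
      (trans (≡.cong₂ _∙_ (ysᴸ≡ε zero) (gprod-pow≡ε L (λ i → ys (suc i)) commuting′ (λ i → ysᴸ≡ε (suc i))))
        (identityʳ ε))
    where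
    commuting′ : ∀ i j → i ≢ j → ys (suc i) ∙ ys (suc j) ≡ ys (suc j) ∙ ys (suc i)
    commuting′ i j i≢j = commuting (suc i) (suc j) (i≢j ∘ Finₚ.suc-injective)
    0≢suc : ∀ {i : Fin r} → zero ≢ suc i
    0≢suc ()

  uniqueMaxCyc-absorbs : ∀ {x g} → (∀ h → IsMaxCyc h → InCyc h x → CycSub h g × CycSub g h) →
                           ∀ {w} → InCyc w x → InCyc g w
  uniqueMaxCyc-absorbs uniq {w} w∋x = absorb (maximal-cyclic-above w)
    where
    absorb : ∃[ h ] CycSub w h × IsMaxCyc h → InCyc _ w
    absorb (h , ⟨w⟩⊆⟨h⟩ , h-max) = proj₁ (uniq h h-max (⟨w⟩⊆⟨h⟩ _ w∋x)) w (⟨w⟩⊆⟨h⟩ w (inCyc-refl w))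

  coprime-to-unique-max⇒∈ : IsNilpotent → ∀ {x g} → (∀ h → IsMaxCyc h → InCyc h x → CycSub h g × CycSub g h) →
                            InCyc g x → ∀ {L u z} → Coprime u L → pow x L ≡ ε → pow z u ≡ ε → InCyc g z
  coprime-to-unique-max⇒∈ nil {x} {g} uniq g∋x {L} {u} {z} u⊥L xᴸ≡ε zᵘ≡ε =
    ≡.subst (InCyc g) (\\-leftDividesʳ x z) (inCyc-∙ (inCyc-⁻¹ g∋x) g∋xz)
    where
    xz≡zx : x ∙ z ≡ z ∙ x
    xz≡zx = sym (nilpotent⇒coprime-commute nil u⊥L zᵘ≡ε xᴸ≡ε)
    xz∋xᵘ : InCyc (x ∙ z) (pow x u)
    xz∋xᵘ = u , trans (pow-distrib u xz≡zx) (trans (cong (pow x u ∙_) zᵘ≡ε) (identityʳ _))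
    g∋xz : InCyc g (x ∙ z)
    g∋xz = uniqueMaxCyc-absorbs uniq (inCyc-trans xz∋xᵘ (coprime-power-generates u⊥L xᴸ≡ε))

  module Components {r} (nil : IsNilpotent) (q : Fin r → ℕ) (P : Fin r → Subset n)
                    (q-coprime : ∀ i j → i ≢ j → Coprime (q i) (q j))
                    (P-exponent : ∀ i {a} → a ∈ P i → pow a (q i) ≡ ε)
                    (xs : Fin r → Fin n) (xs∈P : ∀ i → xs i ∈ P i) where

    trivial-component⇒coprime-exponent : ∀ k → xs k ≡ ε → ∃[ L ] Coprime (q k) L × pow (gprod xs) L ≡ ε
    trivial-component⇒coprime-exponent k xₖ≡ε = ∏ e , coprime-∏ e qₖ⊥e ,
      gprod-pow≡ε (∏ e) xs components-commute (λ i → pow≡ε-∣ (∣∏ e i) (xsᵉ≡ε i))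
      where
      e : Fin r → ℕ
      e i with i ≟ k
      ... | yes _ = 1
      ... | no  _ = q i

      xsᵉ≡ε : ∀ i → pow (xs i) (e i) ≡ ε
      xsᵉ≡ε i with i ≟ k
      ... | yes refl = trans (identityʳ (xs k)) xₖ≡ε
      ... | no  _    = P-exponent i (xs∈P i)

      qₖ⊥e : ∀ i → Coprime (q k) (e i)
      qₖ⊥e i with i ≟ k
      ... | yes _   = Coprimality.sym (1-coprimeTo (q k))
      ... | no  i≢k = q-coprime k i (i≢k ∘ sym)

      components-commute : ∀ i j → i ≢ j → xs i ∙ xs j ≡ xs j ∙ xs i
      components-commute i j i≢j =
        nilpotent⇒coprime-commute nil (q-coprime i j i≢j) (P-exponent i (xs∈P i)) (P-exponent j (xs∈P j))

    trivial-component⇒cyclic : (∀ i → IsSubgroup (P i)) → InUniqueMaxCyc (gprod xs) →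
                               ∀ k → xs k ≡ ε → IsCyclicSub (P k)
    trivial-component⇒cyclic P-subgroup (g , (_ , g∋x) , uniq) k xₖ≡ε
      with trivial-component⇒coprime-exponent k xₖ≡ε
    ... | L , qₖ⊥L , xᴸ≡ε = subgroup-of-cyclic (P-subgroup k) g λ z z∈Pₖ →
      coprime-to-unique-max⇒∈ nil uniq g∋x qₖ⊥L xᴸ≡ε (P-exponent k z∈Pₖ)

open import Data.Nat.Base using (_^_)
open import Data.Nat.Primality using (Prime; prime⇒nonZero)
open import Data.Nat.Coprimality using (prime⇒coprime)
open import Data.Fin as F using ()

coprime-^ : ∀ {m k} → Coprime m k → ∀ a → Coprime m (k ^ a)
coprime-^ {m} _   zero    = Coprimality.sym (1-coprimeTo m)
coprime-^     m⊥k (suc a) = coprime-* m⊥k (coprime-^ m⊥k a)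

coprime-^-^ : ∀ {a b} → Coprime a b → ∀ i j → Coprime (a ^ i) (b ^ j)
coprime-^-^ a⊥b i j = coprime-^ (Coprimality.sym (coprime-^ (Coprimality.sym a⊥b) i)) j

distinct-primePowers-coprime : ∀ {r} (p α : Fin r → ℕ) → (∀ i → Prime (p i)) → (∀ i j → i F.< j → p i < p j) →
                               ∀ i j → i ≢ j → Coprime (p i ^ α i) (p j ^ α j)
distinct-primePowers-coprime p α prime increasing i j i≢j with Finₚ.<-cmp i j
... | tri< i<j _ _ = Coprimality.sym
  (coprime-^-^ (prime⇒coprime (prime j) {{prime⇒nonZero (prime i)}} (increasing i j i<j)) (α j) (α i))
... | tri≈ _ i≡j _ = ⊥-elim (i≢j i≡j)
... | tri> _ _ j<i =
  coprime-^-^ (prime⇒coprime (prime i) {{prime⇒nonZero (prime j)}} (increasing j i j<i)) (α i) (α j)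

lemma3p2 : (n r : ℕ) (G : FinGroup n) (p α : Fin r → ℕ) (P : Fin r → Subset n)
    → 2 ≤ r
    → (∀ i → Prime (p i))
    → (∀ i j → i F.< j → p i < p j)
    → (∀ i → 1 ≤ α i)
    → n ≡ ∏ (λ i → p i ^ α i)
    → FinGroup.IsNilpotent G
    → ¬ FinGroup.IsCyclicGroup G
    → (∀ i → FinGroup.IsSylow G (p i) (α i) (P i))
    → (x : Fin n)
    → x ≢ FinGroup.ε G
    → FinGroup.HasMinDegree G x
    → FinGroup.InUniqueMaxCyc G x
    → (xs : Fin r → Fin n)
    → (∀ i → xs i ∈ P i)
    → FinGroup.gprod G xs ≡ x
    → (∀ k → xs k ≡ FinGroup.ε G → FinGroup.IsCyclicSub G (P k))
    × ((∀ k → ¬ FinGroup.IsCyclicSub G (P k)) → ∀ k → xs k ≢ FinGroup.ε G)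
lemma3p2 n r G p α P _ prime increasing _ _ nilpotent _ sylow x _ _ x-unique xs xs∈P ∏xs≡x =
  sylow-cyclic , λ all-noncyclic k xₖ≡ε → all-noncyclic k (sylow-cyclic k xₖ≡ε)
  where
  open FinGroup G
  open FiniteGroup G

  exponent : ∀ i {a} → a ∈ P i → pow a (p i ^ α i) ≡ ε
  exponent i a∈Pᵢ = ≡.subst (λ m → pow _ m ≡ ε) (proj₂ (sylow i)) (lagrange (proj₁ (sylow i)) a∈Pᵢ)

  sylow-cyclic : ∀ k → xs k ≡ ε → IsCyclicSub (P k)
  sylow-cyclic = Components.trivial-component⇒cyclic nilpotent (λ i → p i ^ α i) P
    (distinct-primePowers-coprime p α prime increasing) exponent xs xs∈P
    (proj₁ ∘ sylow) (≡.subst InUniqueMaxCyc (sym ∏xs≡x) x-unique)
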